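{- Let $u,v,w$ be binary words over $\{0,1\}$. Then (i) $\mathrm{RC}(uv)=\mathrm{RC}(u)\diamond\mathrm{RC}(v)$; (ii) $\mathrm{RC}(\widetilde w)=\widetilde{\mathrm{RC}(w)}$.
   Context: A caterpillar sequence is a finite sequence $(s_1,\dots,s_k)$, $k\ge1$, of non-negative integers with $s_1,s_k\ge1$, and $s_1\ge2$ if $k=1$. The graft is $(s_1,\dots,s_k)\diamond(s'_1,\dots,s'_l)=(s_1,\dots,s_{k-1},s_k+s'_1-2,s'_2,\dots,s'_l)$. The reading caterpillar sequence of a binary word is defined by $\mathrm{RC}(\varepsilon)=(2)$ and, if $\mathrm{RC}(u)=(r_1,\dots,r_k)$, $\mathrm{RC}(u0)=(r_1,\dots,r_{k-1},r_k-1,1)$ and $\mathrm{RC}(u1)=(r_1,\dots,r_{k-1},r_k+1)$ (equivalently $\mathrm{RC}(u0)=\mathrm{RC}(u)\diamond(1,1)$ and $\mathrm{RC}(u1)=\mathrm{RC}(u)\diamond(3)$). $\widetilde w$ denotes the reversal of a word $w$ and $\widetilde{S}=(s_k,\dots,s_1)$ the reversal of a sequence $S=(s_1,\dots,s_k)$. -}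

module Defs where

open import Data.Nat using (ℕ; zero; suc; _+_; _∸_)
open import Data.Bool using (Bool; true; false)
open import Data.List using (List; []; _∷_; _++_; reverse; foldl)

-- Binary letters: false = 0, true = 1.
Word : Set
Word = List Bool

-- Finite sequences of non-negative integers (caterpillar sequences are nonempty ones).
Seq : Set
Seq = List ℕ

-- graft (s₁,…,s_k) ◇ (s'₁,…,s'_l) = (s₁,…,s_{k-1}, s_k + s'₁ - 2, s'₂,…,s'_l)
-- (on caterpillar sequences s_k + s'₁ ≥ 2, so truncated subtraction is exact;
--  the empty-list clauses never arise for caterpillar sequences)
_◇_ : Seq → Seq → Seq
[] ◇ t = t
(s ∷ []) ◇ [] = s ∷ []
(s ∷ []) ◇ (t ∷ ts) = (s + t ∸ 2) ∷ ts
(s ∷ s₂ ∷ ss) ◇ t = s ∷ ((s₂ ∷ ss) ◇ t)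

step : Seq → Bool → Seq
step r false = r ◇ (1 ∷ 1 ∷ [])
step r true  = r ◇ (3 ∷ [])

RC : Word → Seq
RC w = foldl step (2 ∷ []) w

-- RC is built by grafting the letter sequences RC(0) = (1,1) and RC(1) = (3)
-- onto (2), which is a unit for grafting. Grafting is associative as soon as the
-- middle factor is not (0) or (1), so reading a word from any state r grafts
-- its RC onto r; this gives (i). For (ii), reversal turns a graft around, and
-- both letter sequences are palindromes, so (ii) follows from (i) by induction.
module Submission where

open import Defs
open import Data.Bool using (true; false)
open import Data.Empty using (⊥-elim)
open import Data.List using ([]; _∷_; [_]; _++_; _∷ʳ_; reverse; foldl; initLast; _∷ʳ′_)
open import Data.List.Properties using (foldl-++; unfold-reverse; reverse-++; ++-assoc)
open import Data.Nat using (_+_; _∸_; _≤_; s≤s; z≤n)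
open import Data.Nat.Properties using (+-comm; +-assoc; +-∸-assoc; +-∸-comm; m+n∸n≡m)
open import Data.Product using (_×_; _,_)
open import Relation.Binary.PropositionalEquality
  using (_≡_; _≢_; refl; sym; cong; cong₂; module ≡-Reasoning)

-- A graft (r ◇ s) ◇ t ≡ r ◇ (s ◇ t) can only fail when s is (0) or (1),
-- where a truncated subtraction hits zero.
data Wide : Seq → Set where
  long   : ∀ a b s → Wide (a ∷ b ∷ s)
  single : ∀ {a} → 2 ≤ a → Wide (a ∷ [])

∷-◇-≢[] : ∀ a r t → (a ∷ r) ◇ t ≢ []
∷-◇-≢[] a []      []      ()
∷-◇-≢[] a []      (_ ∷ _) ()
∷-◇-≢[] a (_ ∷ _) t       ()

∷-◇ : ∀ a {r} → r ≢ [] → ∀ t → (a ∷ r) ◇ t ≡ a ∷ (r ◇ t)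
∷-◇ a {[]}    r≢[] t = ⊥-elim (r≢[] refl)
∷-◇ a {_ ∷ _} _    t = refl

◇-identityʳ : ∀ {r} → r ≢ [] → r ◇ [ 2 ] ≡ r
◇-identityʳ {[]}         r≢[] = ⊥-elim (r≢[] refl)
◇-identityʳ {a ∷ []}     _    = cong [_] (m+n∸n≡m a 2)
◇-identityʳ {a ∷ b ∷ rs} _    = cong (a ∷_) (◇-identityʳ (λ ()))

◇-[] : ∀ r → r ◇ [] ≡ r
◇-[] []           = refl
◇-[] (a ∷ [])     = refl
◇-[] (a ∷ b ∷ rs) = cong (a ∷_) (◇-[] (b ∷ rs))

◇-assoc : ∀ r {s} → Wide s → ∀ t → (r ◇ s) ◇ t ≡ r ◇ (s ◇ t)
◇-assoc []           _                t        = refl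
◇-assoc (a ∷ [])     (long _ _ _)     t        = refl
◇-assoc (a ∷ [])     (single _)       []       = refl
◇-assoc (a ∷ [])     (single {b} 2≤b) (d ∷ ts) = cong (_∷ ts) (begin
  a + b ∸ 2 + d ∸ 2      ≡⟨ cong (λ n → n + d ∸ 2) (+-∸-assoc a 2≤b) ⟩
  a + (b ∸ 2) + d ∸ 2    ≡⟨ cong (_∸ 2) (+-assoc a (b ∸ 2) d) ⟩
  a + (b ∸ 2 + d) ∸ 2    ≡⟨ cong (λ n → a + n ∸ 2) (sym (+-∸-comm d 2≤b)) ⟩
  a + (b + d ∸ 2) ∸ 2    ∎)
  where open ≡-Reasoning
◇-assoc (a ∷ b ∷ rs) {s} ws t = begin
  (a ∷ ((b ∷ rs) ◇ s)) ◇ t  ≡⟨ ∷-◇ a (∷-◇-≢[] b rs s) t ⟩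
  a ∷ (((b ∷ rs) ◇ s) ◇ t)  ≡⟨ cong (a ∷_) (◇-assoc (b ∷ rs) ws t) ⟩
  a ∷ ((b ∷ rs) ◇ (s ◇ t))  ∎
  where open ≡-Reasoning

∷ʳ-◇ : ∀ xs a b ys → (xs ∷ʳ a) ◇ (b ∷ ys) ≡ xs ++ (a + b ∸ 2) ∷ ys
∷ʳ-◇ []           a b ys = refl
∷ʳ-◇ (x ∷ [])     a b ys = refl
∷ʳ-◇ (x ∷ y ∷ xs) a b ys = cong (x ∷_) (∷ʳ-◇ (y ∷ xs) a b ys)

reverse-◇ : ∀ r s → reverse (r ◇ s) ≡ reverse s ◇ reverse r
reverse-◇ r []       = cong reverse (◇-[] r)
reverse-◇ r (b ∷ ys) with initLast r
... | [] = sym (◇-[] (reverse (b ∷ ys)))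
... | xs ∷ʳ′ a = begin
  reverse ((xs ∷ʳ a) ◇ (b ∷ ys))               ≡⟨ cong reverse (∷ʳ-◇ xs a b ys) ⟩
  reverse (xs ++ (a + b ∸ 2) ∷ ys)             ≡⟨ reverse-++ xs _ ⟩
  reverse ((a + b ∸ 2) ∷ ys) ++ reverse xs     ≡⟨ cong (_++ reverse xs) (unfold-reverse _ ys) ⟩
  (reverse ys ∷ʳ (a + b ∸ 2)) ++ reverse xs    ≡⟨ ++-assoc (reverse ys) _ (reverse xs) ⟩
  reverse ys ++ (a + b ∸ 2) ∷ reverse xs       ≡⟨ cong (λ n → reverse ys ++ (n ∸ 2) ∷ reverse xs) (+-comm a b) ⟩
  reverse ys ++ (b + a ∸ 2) ∷ reverse xs       ≡⟨ sym (∷ʳ-◇ (reverse ys) b a (reverse xs)) ⟩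
  (reverse ys ∷ʳ b) ◇ (a ∷ reverse xs)         ≡⟨ cong₂ _◇_ (sym (unfold-reverse b ys)) (sym (reverse-++ xs [ a ])) ⟩
  reverse (b ∷ ys) ◇ reverse (xs ∷ʳ a)         ∎
  where open ≡-Reasoning

step-≡-◇-RC : ∀ r b → step r b ≡ r ◇ RC [ b ]
step-≡-◇-RC r false = refl
step-≡-◇-RC r true  = refl

RC-letter-wide : ∀ b → Wide (RC [ b ])
RC-letter-wide false = long 1 1 []
RC-letter-wide true  = single (s≤s (s≤s z≤n))

reverse-RC-letter : ∀ b → reverse (RC [ b ]) ≡ RC [ b ]
reverse-RC-letter false = refl
reverse-RC-letter true  = refl

step-≢[] : ∀ {r} b → r ≢ [] → step r b ≢ []
step-≢[] {[]}    b r≢[] = ⊥-elim (r≢[] refl)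
step-≢[] {a ∷ r} b _    rewrite step-≡-◇-RC (a ∷ r) b = ∷-◇-≢[] a r (RC [ b ])

foldl-step-≢[] : ∀ v {r} → r ≢ [] → foldl step r v ≢ []
foldl-step-≢[] []      r≢[] = r≢[]
foldl-step-≢[] (b ∷ v) r≢[] = foldl-step-≢[] v (step-≢[] b r≢[])

RC-≢[] : ∀ w → RC w ≢ []
RC-≢[] w = foldl-step-≢[] w (λ ())

foldl-step-≡-◇ : ∀ v {r} → r ≢ [] → foldl step r v ≡ r ◇ RC v
foldl-step-≡-◇ []      r≢[] = sym (◇-identityʳ r≢[])
foldl-step-≡-◇ (b ∷ v) {r} r≢[] = begin
  foldl step (step r b) v        ≡⟨ foldl-step-≡-◇ v (step-≢[] b r≢[]) ⟩
  step r b ◇ RC v                ≡⟨ cong (_◇ RC v) (step-≡-◇-RC r b) ⟩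
  (r ◇ RC [ b ]) ◇ RC v          ≡⟨ ◇-assoc r (RC-letter-wide b) (RC v) ⟩
  r ◇ (RC [ b ] ◇ RC v)          ≡⟨ cong (r ◇_) (sym (foldl-step-≡-◇ v (RC-≢[] [ b ]))) ⟩
  r ◇ RC (b ∷ v)                 ∎
  where open ≡-Reasoning

RC-++ : ∀ u v → RC (u ++ v) ≡ RC u ◇ RC v
RC-++ u v = begin
  RC (u ++ v)             ≡⟨ foldl-++ step [ 2 ] u v ⟩
  foldl step (RC u) v     ≡⟨ foldl-step-≡-◇ v (RC-≢[] u) ⟩
  RC u ◇ RC v             ∎
  where open ≡-Reasoning

RC-reverse : ∀ w → RC (reverse w) ≡ reverse (RC w)
RC-reverse []      = refl
RC-reverse (b ∷ w) = begin
  RC (reverse (b ∷ w))                 ≡⟨ cong RC (unfold-reverse b w) ⟩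
  RC (reverse w ∷ʳ b)                  ≡⟨ RC-++ (reverse w) [ b ] ⟩
  RC (reverse w) ◇ RC [ b ]            ≡⟨ cong₂ _◇_ (RC-reverse w) (sym (reverse-RC-letter b)) ⟩
  reverse (RC w) ◇ reverse (RC [ b ])  ≡⟨ sym (reverse-◇ (RC [ b ]) (RC w)) ⟩
  reverse (RC [ b ] ◇ RC w)            ≡⟨ cong reverse (sym (RC-++ [ b ] w)) ⟩
  reverse (RC (b ∷ w))                 ∎
  where open ≡-Reasoning

lemma6 : (∀ (u v : Word) → RC (u ++ v) ≡ RC u ◇ RC v)
         × (∀ (w : Word) → RC (reverse w) ≡ reverse (RC w))
lemma6 = RC-++ , RC-reverse
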